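{- Let $(M,*)$ be a magma and $n\ge 2$ an integer. Then the following are equivalent: (i) for every $f\in GSF(n,M)$ and all $i,j\in\{1,\dots,n\}$ one has $A(i)\circ A(j)(f)=A(j)\circ A(i)(f)$; (ii) $(a*b)*(c*d)=(a*c)*(b*d)$ for all $a,b,c,d\in M$.
   Context: A magma $(M,*)$ is a set $M$ with a binary operation $*:M\times M\to M$ (no axioms). For $n\in\mathbb{N}$, $GSF(n,M)$ is the set of all functions $\{0,1\}^n\to M$. For $i\in\{1,\dots,n\}$ the abstraction $A(i):GSF(n,M)\to GSF(n,M)$ is defined by $A(i)(f)(b_1,\dots,b_n)=f(b_1,\dots,b_{i-1},0,b_{i+1},\dots,b_n)*f(b_1,\dots,b_{i-1},1,b_{i+1},\dots,b_n)$. -}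

module Defs where

open import Data.Bool using (Bool; false; true)
open import Data.Nat using (ℕ)
open import Data.Fin using (Fin)
open import Data.Vec using (Vec; _[_]≔_)

-- GSF(n,M): functions {0,1}^n → M, with {0,1}^n rendered as Vec Bool n
-- (false = 0, true = 1) and coordinates indexed by Fin n (i ↦ i+1).
GSF : ℕ → Set → Set
GSF n M = Vec Bool n → M

A : {M : Set} → (M → M → M) → {n : ℕ} → Fin n → GSF n M → GSF n M
A _*_ i f b = f (b [ i ]≔ false) * f (b [ i ]≔ true)

-- Iterating two abstractions A(i), A(j) with i ≠ j evaluates f on the 2×2 square of points
-- obtained by setting coordinates i and j of b to 0/1; A(i) ∘ A(j) combines this square
-- row by row, A(j) ∘ A(i) column by column, and the two agree exactly when the medial law
-- holds. Conversely, a function on the first two coordinates realises any square a, b, c, d.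
module Submission where

open import Defs
open import Data.Bool using (Bool; true; false)
open import Data.Nat using (ℕ; suc; _≤_; s≤s; z≤n)
open import Data.Fin using (Fin; zero; suc)
open import Data.Fin.Properties using (_≟_)
open import Data.Vec using (Vec; _∷_; _[_]≔_; replicate)
open import Data.Vec.Properties using ([]≔-commutes)
open import Data.Product using (_×_; _,_)
open import Relation.Nullary using (yes; no)
open import Relation.Binary.PropositionalEquality using (_≡_; refl; cong; cong₂; module ≡-Reasoning)

module _ {M : Set} (_*_ : M → M → M) where

  Medial : Set
  Medial = ∀ a b c d → (a * b) * (c * d) ≡ (a * c) * (b * d)

  AbstractionsCommute : ℕ → Set
  AbstractionsCommute n = ∀ (f : GSF n M) (i j : Fin n) (b : Vec Bool n) →
    A _*_ i (A _*_ j f) b ≡ A _*_ j (A _*_ i f) b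

  combineRows : (Bool → Bool → M) → M
  combineRows g = (g false false * g false true) * (g true false * g true true)

  combineColumns : (Bool → Bool → M) → M
  combineColumns g = (g false false * g true false) * (g false true * g true true)

  combineColumns-cong : ∀ {g h} → (∀ x y → g x y ≡ h x y) →
                        combineColumns g ≡ combineColumns h
  combineColumns-cong g≗h =
    cong₂ _*_ (cong₂ _*_ (g≗h false false) (g≗h true false))
              (cong₂ _*_ (g≗h false true) (g≗h true true))

  medial⇒abstractionsCommute : Medial → ∀ n → AbstractionsCommute n
  medial⇒abstractionsCommute medial n f i j b with i ≟ j
  ... | yes refl = refl
  ... | no i≢j = begin
    A _*_ i (A _*_ j f) b                              ≡⟨⟩
    combineRows (λ x y → f (b [ i ]≔ x [ j ]≔ y))      ≡⟨ medial _ _ _ _ ⟩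
    combineColumns (λ x y → f (b [ i ]≔ x [ j ]≔ y))
      ≡⟨ combineColumns-cong (λ x y → cong f ([]≔-commutes {x = x} {y = y} b i j i≢j)) ⟩
    combineColumns (λ x y → f (b [ j ]≔ y [ i ]≔ x))   ≡⟨⟩
    A _*_ j (A _*_ i f) b                              ∎
    where open ≡-Reasoning

  square : ∀ {m} → (Bool → Bool → M) → GSF (suc (suc m)) M
  square g (x ∷ y ∷ _) = g x y

  abstractionsCommute⇒medial : ∀ m → AbstractionsCommute (suc (suc m)) → Medial
  abstractionsCommute⇒medial m commute a b c d =
    commute (square table) zero (suc zero) (replicate _ false)
    where
    table : Bool → Bool → M
    table false false = a
    table false true  = b
    table true  false = c
    table true  true  = d

lemma2 : (M : Set) (_*_ : M → M → M) (n : ℕ) → 2 ≤ n →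
    ((∀ (f : GSF n M) (i j : Fin n) (b : Vec Bool n) →
        A _*_ i (A _*_ j f) b ≡ A _*_ j (A _*_ i f) b)
     → (∀ a b c d → (a * b) * (c * d) ≡ (a * c) * (b * d)))
    × ((∀ a b c d → (a * b) * (c * d) ≡ (a * c) * (b * d))
     → (∀ (f : GSF n M) (i j : Fin n) (b : Vec Bool n) →
        A _*_ i (A _*_ j f) b ≡ A _*_ j (A _*_ i f) b))
lemma2 M _*_ (suc (suc m)) (s≤s (s≤s z≤n)) =
  abstractionsCommute⇒medial _*_ m ,
  λ medial → medial⇒abstractionsCommute _*_ medial (suc (suc m))
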